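{- Let $p$ be a prime, let $m$ be a positive integer divisible by $3$, let $n=\frac m3(p-1)$ and $U=[0,n]^2$. Let $i$ be an integer with $0\le i\le n$, let $J_{i+1},\dots,J_n$ be a backward consistent sequence of ideals of $U$, and let $J_i$ be an ideal of $U$. Then $J_i$ is consistent with $J_{i+1},\dots,J_n$ if and only if the following conditions hold: (i) $J_i\supseteq J_{i+1}$; (ii) $\bigl[J_i+D-(0,p)\bigr]\cap U\subseteq J_{i+1}$; (iii) $\bigl[J_{i+p}+D+(1,0)\bigr]\cap U\subseteq J_i$ (this condition is void if $i+p>n$); (iv) if there exists an integer $\alpha$ with $1\le\alpha\le p-1$, $i+\alpha\le n$ and $J_{i+\alpha}\neq\emptyset$, then, letting $\alpha_i$ be the largest such integer, $\bigl[J_{i+\alpha_i}+D+(1,-p^2+p\alpha_i)\bigr]\cap U\subseteq J_i$ (if no such $\alpha$ exists, this condition is void).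
   Context: $D=\{(x,y)\in\mathbb{R}^2: x+py\le 0,\ p^2x+y\le 0\}$ and $\Delta=\{(x,y,z)\in\mathbb{R}^3: x+py+p^2z\le 0,\ p^2x+y+pz\le 0,\ px+p^2y+z\le 0\}$. For $u,v\in\mathbb{R}^2$, $u\prec v$ means $u\in v+D$; for $u,v\in\mathbb{R}^3$, $u\prec v$ means $u\in v+\Delta$. For $\Omega\subseteq\mathbb{R}^2$ or $\mathbb{R}^3$, an ideal of $\Omega$ is a subset $I\subseteq\Omega$ such that $u\in I$, $v\in\Omega$, $v\prec u$ imply $v\in I$. For integers $a\le b$, $[a,b]=\{x\in\mathbb{Z}:a\le x\le b\}$. Sums like $J+D+(a,b)$ are Minkowski sums in $\mathbb{R}^2$. A sequence $J_{i+1},\dots,J_n$ of ideals of $U$ is backward consistent if $\bigcup_{j=i+1}^n(J_j\times\{j\})$ is an ideal of $U\times[i+1,n]$ (with respect to $\prec$ on $\mathbb{R}^3$); $J_i$ is consistent with $J_{i+1},\dots,J_n$ if $J_i,J_{i+1},\dots,J_n$ is backward consistent. -}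

module Defs where

open import Data.Nat as ℕ using (ℕ; suc)
open import Data.Integer using (ℤ; +_; _+_; _-_; _*_; -_; _≤_; 0ℤ)
open import Data.Bool using (Bool; true)
open import Data.Product using (_×_; ∃₂)
open import Relation.Binary.PropositionalEquality using (_≡_)

Sub2 : Set
Sub2 = ℤ → ℤ → Bool

InD : ℕ → ℤ → ℤ → Set
InD p x y = (x + P * y ≤ 0ℤ) × (P * P * x + y ≤ 0ℤ)
  where P = + p

InΔ : ℕ → ℤ → ℤ → ℤ → Set
InΔ p x y z =
  (x + P * y + P * P * z ≤ 0ℤ) × (P * P * x + y + P * z ≤ 0ℤ) × (P * x + P * P * y + z ≤ 0ℤ)
  where P = + p

InU : ℕ → ℤ → ℤ → Set
InU n x y = (0ℤ ≤ x) × (x ≤ + n) × (0ℤ ≤ y) × (y ≤ + n)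

-- J is an ideal of U (w.r.t. ≺ : u ≺ v iff u ∈ v + D)
IsIdeal : ℕ → ℕ → Sub2 → Set
IsIdeal p n J =
  (∀ x y → J x y ≡ true → InU n x y) ×
  (∀ x y x' y' → J x y ≡ true → InU n x' y' → InD p (x' - x) (y' - y) → J x' y' ≡ true)

-- ⋃_{j=k}^{n} (J j × {j}) is an ideal of U × [k,n] (w.r.t. ≺ on ℝ³ given by Δ)
IdealFrom : ℕ → ℕ → (ℕ → Sub2) → ℕ → Set
IdealFrom p n J k =
  (∀ j → k ℕ.≤ j → j ℕ.≤ n → ∀ x y → J j x y ≡ true → InU n x y) ×
  (∀ j x y j' x' y' → k ℕ.≤ j → j ℕ.≤ n → J j x y ≡ true →
     k ℕ.≤ j' → j' ℕ.≤ n → InU n x' y' →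
     InΔ p (x' - x) (y' - y) (+ j' - + j) → J j' x' y' ≡ true)

BackwardConsistent : ℕ → ℕ → (ℕ → Sub2) → ℕ → Set
BackwardConsistent = IdealFrom

ShiftIncl : ℕ → ℕ → Sub2 → Sub2 → ℤ → ℤ → Set
ShiftIncl p n A B a b =
  ∀ x y x' y' → A x y ≡ true → InU n x' y' →
    InD p (x' - (x + a)) (y' - (y + b)) → B x' y' ≡ true

Admissible : ℕ → ℕ → (ℕ → Sub2) → ℕ → ℕ → Set
Admissible p n J i α =
  (1 ℕ.≤ α) × (α ℕ.≤ p ℕ.∸ 1) × (i ℕ.+ α ℕ.≤ n) × ∃₂ (λ x y → J (i ℕ.+ α) x y ≡ true)

IsLargestAdmissible : ℕ → ℕ → (ℕ → Sub2) → ℕ → ℕ → Set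
IsLargestAdmissible p n J i α =
  Admissible p n J i α × (∀ β → Admissible p n J i β → β ℕ.≤ α)

-- the four conditions (i)–(iv); (i),(ii) are imposed only when i+1 ≤ n
Conditions : ℕ → ℕ → (ℕ → Sub2) → ℕ → Set
Conditions p n J i =
  (suc i ℕ.≤ n → ∀ x y → J (suc i) x y ≡ true → J i x y ≡ true) ×
  (suc i ℕ.≤ n → ShiftIncl p n (J i) (J (suc i)) 0ℤ (- (+ p))) ×
  (i ℕ.+ p ℕ.≤ n → ShiftIncl p n (J (i ℕ.+ p)) (J i) (+ 1) 0ℤ) ×
  (∀ α → IsLargestAdmissible p n J i α →
     ShiftIncl p n (J (i ℕ.+ α)) (J i) (+ 1) (- (+ p * + p) + + p * + α))

-- Consistency of J_i with J_{i+1}, …, J_n means that the union of the layers J_j × {j}, j ≥ i,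
-- is closed under the cone Δ.  Conditions (i)–(iv) are necessary because (0,0,-1),
-- (D - (0,p)) × {1}, (D + (1,0)) × {-p} and (D + (1,-p²+pα)) × {-α} (for α ≤ p - 1) lie in Δ.
-- Conversely, besides steps inside the ideal J_i, only Δ-steps between level i and a level i + c
-- with c ≥ 1 need checking, the layers above i being consistent by hypothesis.  An upward
-- step factors through level i + 1, entered by (ii).  A downward step factors through a point w
-- at level i + 1, i + p or i + α_i (where c ≤ α_i when c < p), left by (i), (iii) or (iv); the
-- point w is chosen by comparing c with p and the positions of the two endpoints.  Every
-- geometric fact used is a linear inequality with coefficients polynomial in p.

module Submission where

open import Defs
open import Data.Nat as ℕ using (ℕ; zero; suc; z≤n)
import Data.Nat.Properties as ℕP
open import Data.Integer as ℤ using (ℤ; +_; 0ℤ)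
open import Data.Bool using (true; false)
open import Data.Product using (_×_; _,_; proj₁; proj₂; ∃-syntax)
open import Data.Empty using (⊥)
open import Data.List using (_∷_; [])
open import Relation.Nullary using (yes; no; contradiction)
import Relation.Unary as U
open import Relation.Binary.PropositionalEquality using (_≡_; refl; sym; trans; subst)

module IntegerArithmetic where

  open import Data.Integer hiding (suc)
  open import Data.Integer.Properties
  open import Data.Integer.Tactic.RingSolver using (solve-∀)

  -- Linear inequalities are proved from certificates: L ≤ R follows once R - L is written
  -- (and checked by the ring solver) as a sum of products of quantities known to be nonnegative.
  ≤-by : ∀ {L R E} → 0ℤ ≤ E → E ≡ R - L → L ≤ R
  ≤-by 0≤E E≡R-L = 0≤i-j⇒j≤i (subst (0ℤ ≤_) E≡R-L 0≤E)

  slack : ∀ {a b} → a ≤ b → 0ℤ ≤ b - a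
  slack = i≤j⇒0≤j-i

  nonneg : ∀ n → 0ℤ ≤ + n
  nonneg n = +≤+ z≤n

  infixl 6 _⊕_
  infixl 7 _⊗_

  _⊕_ : ∀ {a b} → 0ℤ ≤ a → 0ℤ ≤ b → 0ℤ ≤ a + b
  _⊕_ = +-mono-≤

  _⊗_ : ∀ {a b} → 0ℤ ≤ a → 0ℤ ≤ b → 0ℤ ≤ a * b
  _⊗_ {+ m} {+ n} _ _ = subst (0ℤ ≤_) (pos-* m n) (nonneg (m ℕ.* n))

  impossible : ∀ {E} k → 0ℤ ≤ E → E + + suc k ≡ 0ℤ → ⊥
  impossible k 0≤E eq with subst (+ suc k ≤_) eq (+-mono-≤ 0≤E (≤-refl {+ suc k}))
  ... | +≤+ ()

  <⇒+1≤ : ∀ {a b} → a < b → a + + 1 ≤ b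
  <⇒+1≤ {a} {b} a<b = subst (_≤ b) (+-comm (+ 1) a) (i<j⇒suc[i]≤j a<b)

  Square : ℤ → ℤ → ℤ → Set
  Square N x y = (0ℤ ≤ x) × (x ≤ N) × (0ℤ ≤ y) × (y ≤ N)

  -- Differences of levels; + (m ℕ.+ n) is definitionally + m + + n, so these apply to ℕ levels.
  [i+b]-[i+c]≡b-c : ∀ i b c → (i + b) - (i + c) ≡ b - c
  [i+b]-[i+c]≡b-c = solve-∀

  [i+c]-i≡c : ∀ i c → (i + c) - i ≡ c
  [i+c]-i≡c = solve-∀

  i-[i+c]≡-c : ∀ i c → i - (i + c) ≡ - c
  i-[i+c]≡-c = solve-∀

  [i+c]-[1+i]≡c-1 : ∀ i c → (i + c) - (+ 1 + i) ≡ c - + 1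
  [i+c]-[1+i]≡c-1 = solve-∀

  [1+i]-[i+c]≡1-c : ∀ i c → (+ 1 + i) - (i + c) ≡ + 1 - c
  [1+i]-[i+c]≡1-c = solve-∀

  i-[1+i]≡-1 : ∀ i → i - (+ 1 + i) ≡ - + 1
  i-[1+i]≡-1 = solve-∀

  [1+i]-i≡1 : ∀ i → (+ 1 + i) - i ≡ + 1
  [1+i]-i≡1 = solve-∀

module Cone (P : ℤ) (2≤P : + 2 ℤ.≤ P) where

  open import Data.Integer hiding (suc)
  open import Data.Integer.Properties using (≤-trans; <-≤-trans; *-cancelˡ-≤-pos; *-zeroʳ; ≮⇒≥; ≰⇒>)
  open import Data.Integer.Tactic.RingSolver using (solve)
  open IntegerArithmetic

  D : ℤ → ℤ → Set
  D a b = (a + P * b ≤ 0ℤ) × (P * P * a + b ≤ 0ℤ)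

  Δ : ℤ → ℤ → ℤ → Set
  Δ a b c = (a + P * b + P * P * c ≤ 0ℤ) × (P * P * a + b + P * c ≤ 0ℤ) × (P * a + P * P * b + c ≤ 0ℤ)

  0≤P : 0ℤ ≤ P
  0≤P = ≤-trans (nonneg 2) 2≤P

  0≤P³-1 : 0ℤ ≤ P * P * P - + 1
  0≤P³-1 = ≤-by ((slack 2≤P ⊕ nonneg 1) ⊗ (P-2+2 ⊗ P-2+2 ⊕ P-2+2 ⊕ nonneg 1)) (solve (P ∷ []))
    where
    P-2+2 : 0ℤ ≤ P - + 2 + + 2
    P-2+2 = slack 2≤P ⊕ nonneg 2

  0≤P*x⇒0≤x : ∀ x → 0ℤ ≤ P * x → 0ℤ ≤ x
  0≤P*x⇒0≤x x 0≤Px =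
    *-cancelˡ-≤-pos 0ℤ x P {{positive (<-≤-trans (+<+ ℕ.z<s) 2≤P)}} (subst (_≤ P * x) (sym (*-zeroʳ P)) 0≤Px)

  Δ⟨0⟩⊆D : ∀ a b → Δ a b 0ℤ → D a b
  Δ⟨0⟩⊆D a b (r₁ , r₂ , _) = ≤-by (slack r₁) (solve (P ∷ a ∷ b ∷ [])) , ≤-by (slack r₂) (solve (P ∷ a ∷ b ∷ []))

  D∋⟨-x,-y⟩ : ∀ x y → 0ℤ ≤ x → 0ℤ ≤ y → D (0ℤ - x) (0ℤ - y)
  D∋⟨-x,-y⟩ x y 0≤x 0≤y =
    ≤-by (slack 0≤x ⊕ 0≤P ⊗ slack 0≤y) (solve (P ∷ x ∷ y ∷ [])) ,
    ≤-by (0≤P ⊗ 0≤P ⊗ slack 0≤x ⊕ slack 0≤y) (solve (P ∷ x ∷ y ∷ []))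

  ⟨0,0,-1⟩∈Δ : ∀ x y → Δ (x - x) (y - y) (- + 1)
  ⟨0,0,-1⟩∈Δ x y =
    ≤-by (0≤P ⊗ 0≤P) (solve (P ∷ x ∷ y ∷ [])) ,
    ≤-by 0≤P (solve (P ∷ x ∷ y ∷ [])) ,
    ≤-by (nonneg 1) (solve (P ∷ x ∷ y ∷ []))

  D+⟨0,-P⟩⊆Δ⟨1⟩ : ∀ x y x' y' → D (x' - (x + 0ℤ)) (y' - (y + - P)) → Δ (x' - x) (y' - y) (+ 1)
  D+⟨0,-P⟩⊆Δ⟨1⟩ x y x' y' (h₁ , h₂) =
    ≤-by (slack h₁) (solve (P ∷ x ∷ y ∷ x' ∷ y' ∷ [])) ,
    ≤-by (slack h₂) (solve (P ∷ x ∷ y ∷ x' ∷ y' ∷ [])) ,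
    ≤-by (0≤P ⊗ slack h₁ ⊕ 0≤P³-1) (solve (P ∷ x ∷ y ∷ x' ∷ y' ∷ []))

  D+⟨1,0⟩⊆Δ⟨-P⟩ : ∀ x y x' y' → D (x' - (x + + 1)) (y' - (y + 0ℤ)) → Δ (x' - x) (y' - y) (- P)
  D+⟨1,0⟩⊆Δ⟨-P⟩ x y x' y' (h₁ , h₂) =
    ≤-by (slack h₁ ⊕ 0≤P³-1) (solve (P ∷ x ∷ y ∷ x' ∷ y' ∷ [])) ,
    ≤-by (slack h₂) (solve (P ∷ x ∷ y ∷ x' ∷ y' ∷ [])) ,
    ≤-by (0≤P ⊗ slack h₁) (solve (P ∷ x ∷ y ∷ x' ∷ y' ∷ []))

  D+⟨1,PA-P²⟩⊆Δ⟨-A⟩ : ∀ A x y x' y' → A ≤ P - + 1 →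
    D (x' - (x + + 1)) (y' - (y + (- (P * P) + P * A))) → Δ (x' - x) (y' - y) (- A)
  D+⟨1,PA-P²⟩⊆Δ⟨-A⟩ A x y x' y' A≤P-1 (h₁ , h₂) =
    ≤-by (slack h₁ ⊕ 0≤P³-1) (solve (P ∷ A ∷ x ∷ y ∷ x' ∷ y' ∷ [])) ,
    ≤-by (slack h₂) (solve (P ∷ A ∷ x ∷ y ∷ x' ∷ y' ∷ [])) ,
    ≤-by (0≤P ⊗ slack h₁ ⊕ 0≤P³-1 ⊗ (slack A≤P-1 ⊕ nonneg 1)) (solve (P ∷ A ∷ x ∷ y ∷ x' ∷ y' ∷ []))

  -- An upward step from s to t across C ≥ 1 levels passes through a point w one level above s:
  -- "raise": w = t + (0 , P (C - 1)),  or  "lower": w = s - (0 , P).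

  raise-D : ∀ C sx sy tx ty → Δ (tx - sx) (ty - sy) C →
    D (tx - (sx + 0ℤ)) ((ty + P * (C - + 1)) - (sy + - P))
  raise-D C sx sy tx ty (h₁ , h₂ , _) =
    ≤-by (slack h₁) (solve (P ∷ C ∷ sx ∷ sy ∷ tx ∷ ty ∷ [])) ,
    ≤-by (slack h₂) (solve (P ∷ C ∷ sx ∷ sy ∷ tx ∷ ty ∷ []))

  raise-Δ : ∀ C tx ty → + 1 ≤ C → Δ (tx - tx) (ty - (ty + P * (C - + 1))) (C - + 1)
  raise-Δ C tx ty 1≤C =
    ≤-by (nonneg 0) (solve (P ∷ C ∷ tx ∷ ty ∷ [])) ,
    ≤-by (nonneg 0) (solve (P ∷ C ∷ tx ∷ ty ∷ [])) ,
    ≤-by (0≤P³-1 ⊗ slack 1≤C) (solve (P ∷ C ∷ tx ∷ ty ∷ []))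

  raise-square : ∀ C N tx ty → + 1 ≤ C → Square N tx ty → ty + P * (C - + 1) ≤ N →
    Square N tx (ty + P * (C - + 1))
  raise-square C N tx ty 1≤C (0≤tx , tx≤N , 0≤ty , _) raised≤N =
    0≤tx , tx≤N , ≤-by (slack 0≤ty ⊕ 0≤P ⊗ slack 1≤C) (solve (P ∷ C ∷ ty ∷ [])) , raised≤N

  lower-P≤sy : ∀ C N sx sy tx ty → Square N sx sy → Square N tx ty → Δ (tx - sx) (ty - sy) C →
    N < ty + P * (C - + 1) → P ≤ sy
  lower-P≤sy C N sx sy tx ty (0≤sx , sx≤N , _) (0≤tx , _) (h₁ , _) N<raised = ≮⇒≥ λ (sy<P : sy < P) →
    impossible 3
      (slack h₁ ⊕ slack 0≤tx ⊕ slack sx≤N ⊕ 0≤P ⊗ slack (<⇒+1≤ N<raised) ⊕ 0≤P ⊗ slack (<⇒+1≤ sy<P)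
        ⊕ slack 2≤P ⊗ slack 0≤N ⊕ slack 0≤N ⊕ nonneg 2 ⊗ slack 2≤P)
      (solve (P ∷ C ∷ N ∷ sx ∷ sy ∷ tx ∷ ty ∷ []))
    where
    0≤N : 0ℤ ≤ N
    0≤N = ≤-trans 0≤sx sx≤N

  lower-D : ∀ sx sy → D (sx - (sx + 0ℤ)) ((sy - P) - (sy + - P))
  lower-D sx sy = ≤-by (nonneg 0) (solve (P ∷ sx ∷ sy ∷ [])) , ≤-by (nonneg 0) (solve (P ∷ sx ∷ sy ∷ []))

  lower-Δ : ∀ C sx sy tx ty → + 1 ≤ C → Δ (tx - sx) (ty - sy) C →
    Δ (tx - sx) (ty - (sy - P)) (C - + 1)
  lower-Δ C sx sy tx ty 1≤C (h₁ , h₂ , _) =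
    ≤-by (slack h₁) (solve (P ∷ C ∷ sx ∷ sy ∷ tx ∷ ty ∷ [])) ,
    ≤-by (slack h₂) (solve (P ∷ C ∷ sx ∷ sy ∷ tx ∷ ty ∷ [])) ,
    ≤-by (0≤P ⊗ slack h₁ ⊕ 0≤P³-1 ⊗ slack 1≤C) (solve (P ∷ C ∷ sx ∷ sy ∷ tx ∷ ty ∷ []))

  lower-square : ∀ N sx sy → Square N sx sy → P ≤ sy → Square N sx (sy - P)
  lower-square N sx sy (0≤sx , sx≤N , _ , sy≤N) P≤sy =
    0≤sx , sx≤N , ≤-by (slack P≤sy) (solve (P ∷ sy ∷ [])) , ≤-by (slack sy≤N ⊕ 0≤P) (solve (P ∷ N ∷ sy ∷ []))

  -- A downward step from t to s across C ≥ 1 levels passes through a point w that lies k levels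
  -- above s, from which s is reached by a condition of the theorem:
  -- "next": w = s, k = 1, by (i);  "left": w = s - (1 , 0), k = P, by (iii);
  -- "corner": w = (P - 1 , sy - 1), k = P, by (iii);  "slant": w = s - (1 , P A - P²), k = A, by (iv).

  next-Δ : ∀ C sx sy tx ty → + 1 ≤ C → sx ≤ tx → P * ((sx - tx) + P * (sy - ty)) ≤ C - + 1 →
    Δ (sx - tx) (sy - ty) (+ 1 - C)
  next-Δ C sx sy tx ty 1≤C sx≤tx Pu≤C-1 = r₁ , r₂ , ≤-by (slack Pu≤C-1) (solve (P ∷ C ∷ sx ∷ sy ∷ tx ∷ ty ∷ []))
    where
    X₁ : 0ℤ ≤ P * P * (C - + 1) - ((sx - tx) + P * (sy - ty))
    X₁ = 0≤P*x⇒0≤x _ (≤-by (slack Pu≤C-1 ⊕ 0≤P³-1 ⊗ slack 1≤C) (solve (P ∷ C ∷ sx ∷ sy ∷ tx ∷ ty ∷ [])))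
    r₁ : (sx - tx) + P * (sy - ty) + P * P * (+ 1 - C) ≤ 0ℤ
    r₁ = ≤-by (slack X₁) (solve (P ∷ C ∷ sx ∷ sy ∷ tx ∷ ty ∷ []))
    X₂ : 0ℤ ≤ P * (C - + 1) - (P * P * (sx - tx) + (sy - ty))
    X₂ = 0≤P*x⇒0≤x _ (0≤P*x⇒0≤x _
      (≤-by (slack Pu≤C-1 ⊕ 0≤P³-1 ⊗ slack 1≤C ⊕ 0≤P ⊗ 0≤P³-1 ⊗ slack sx≤tx)
        (solve (P ∷ C ∷ sx ∷ sy ∷ tx ∷ ty ∷ []))))
    r₂ : P * P * (sx - tx) + (sy - ty) + P * (+ 1 - C) ≤ 0ℤ
    r₂ = ≤-by (slack X₂) (solve (P ∷ C ∷ sx ∷ sy ∷ tx ∷ ty ∷ []))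

  next-small : ∀ C sx sy tx ty → + 1 ≤ C → C ≤ P - + 1 → Δ (sx - tx) (sy - ty) (- C) →
    P * ((sx - tx) + P * (sy - ty)) ≤ C - + 1
  next-small C sx sy tx ty 1≤C C≤P-1 (_ , _ , g₃) =
    ≤-by (0≤P ⊗ slack u≤0 ⊕ slack 1≤C) (solve (P ∷ C ∷ sx ∷ sy ∷ tx ∷ ty ∷ []))
    where
    u≤0 : (sx - tx) + P * (sy - ty) ≤ 0ℤ
    u≤0 = ≮⇒≥ λ (0<u : 0ℤ < (sx - tx) + P * (sy - ty)) →
      impossible 0 (slack g₃ ⊕ 0≤P ⊗ slack (<⇒+1≤ 0<u) ⊕ slack C≤P-1) (solve (P ∷ C ∷ sx ∷ sy ∷ tx ∷ ty ∷ []))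

  left-Δ : ∀ C sx sy tx ty → P ≤ C → Δ (sx - tx) (sy - ty) (- C) →
    Δ ((sx - + 1) - tx) (sy - ty) (P - C)
  left-Δ C sx sy tx ty P≤C (_ , g₂ , g₃) =
    r₁ , ≤-by (slack g₂) (solve (P ∷ C ∷ sx ∷ sy ∷ tx ∷ ty ∷ [])) , ≤-by (slack g₃)
      (solve (P ∷ C ∷ sx ∷ sy ∷ tx ∷ ty ∷ []))
    where
    X : 0ℤ ≤ 0ℤ - ((sx - + 1 - tx) + P * (sy - ty) + P * P * (P - C))
    X = 0≤P*x⇒0≤x _ (≤-by (slack g₃ ⊕ 0≤P³-1 ⊗ slack P≤C) (solve (P ∷ C ∷ sx ∷ sy ∷ tx ∷ ty ∷ [])))
    r₁ : (sx - + 1 - tx) + P * (sy - ty) + P * P * (P - C) ≤ 0ℤ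
    r₁ = ≤-by (slack X) (solve (P ∷ C ∷ sx ∷ sy ∷ tx ∷ ty ∷ []))

  left-square : ∀ N sx sy → Square N sx sy → + 1 ≤ sx → Square N (sx - + 1) sy
  left-square N sx sy (_ , sx≤N , 0≤sy , sy≤N) 1≤sx =
    ≤-by (slack 1≤sx) (solve (sx ∷ [])) , ≤-by (slack sx≤N ⊕ nonneg 1) (solve (N ∷ sx ∷ [])) , 0≤sy , sy≤N

  left-D : ∀ sx sy → D (sx - ((sx - + 1) + + 1)) (sy - (sy + 0ℤ))
  left-D sx sy = ≤-by (nonneg 0) (solve (P ∷ sx ∷ sy ∷ [])) , ≤-by (nonneg 0) (solve (P ∷ sx ∷ sy ∷ []))

  corner-ty<sy : ∀ C sx sy tx ty → sx ≤ 0ℤ → 0ℤ ≤ tx → + 1 ≤ C →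
    C - + 1 < P * ((sx - tx) + P * (sy - ty)) → ty + + 1 ≤ sy
  corner-ty<sy C sx sy tx ty sx≤0 0≤tx 1≤C C-1<Pu = <⇒+1≤ (≰⇒> λ (sy≤ty : sy ≤ ty) →
    impossible 0
      (0≤P ⊗ (slack sx≤0 ⊕ slack 0≤tx) ⊕ 0≤P ⊗ 0≤P ⊗ slack sy≤ty ⊕ slack (<⇒+1≤ C-1<Pu) ⊕ slack 1≤C)
      (solve (P ∷ C ∷ sx ∷ sy ∷ tx ∷ ty ∷ [])))

  corner-Δ : ∀ C sx sy tx ty → 0ℤ ≤ sx → P ≤ C → ty + + 1 ≤ sy → Δ (sx - tx) (sy - ty) (- C) →
    Δ ((P - + 1) - tx) ((sy - + 1) - ty) (P - C)
  corner-Δ C sx sy tx ty 0≤sx P≤C ty<sy (_ , _ , g₃) =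
    r₁ ,
    ≤-by (0≤P ⊗ slack g₃ ⊕ 0≤P³-1 ⊗ slack ty<sy ⊕ 0≤P ⊗ 0≤P ⊗ slack 0≤sx)
      (solve (P ∷ C ∷ sx ∷ sy ∷ tx ∷ ty ∷ [])) ,
    ≤-by (slack g₃ ⊕ 0≤P ⊗ slack 0≤sx) (solve (P ∷ C ∷ sx ∷ sy ∷ tx ∷ ty ∷ []))
    where
    X : 0ℤ ≤ 0ℤ - ((P - + 1 - tx) + P * (sy - + 1 - ty) + P * P * (P - C))
    X = 0≤P*x⇒0≤x _
      (≤-by (slack g₃ ⊕ 0≤P³-1 ⊗ slack P≤C ⊕ 0≤P ⊗ slack 0≤sx) (solve (P ∷ C ∷ sx ∷ sy ∷ tx ∷ ty ∷ [])))
    r₁ : (P - + 1 - tx) + P * (sy - + 1 - ty) + P * P * (P - C) ≤ 0ℤ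
    r₁ = ≤-by (slack X) (solve (P ∷ C ∷ sx ∷ sy ∷ tx ∷ ty ∷ []))

  corner-square : ∀ C N sx sy tx ty → Square N sx sy → Square N tx ty → P ≤ C → C ≤ N → ty + + 1 ≤ sy →
    Square N (P - + 1) (sy - + 1)
  corner-square C N sx sy tx ty (_ , _ , _ , sy≤N) (_ , _ , 0≤ty , _) P≤C C≤N ty<sy =
    ≤-by (slack 2≤P ⊕ nonneg 1) (solve (P ∷ [])) ,
    ≤-by (slack P≤C ⊕ slack C≤N ⊕ nonneg 1) (solve (P ∷ C ∷ N ∷ [])) ,
    ≤-by (slack ty<sy ⊕ slack 0≤ty) (solve (sy ∷ ty ∷ [])) ,
    ≤-by (slack sy≤N ⊕ nonneg 1) (solve (N ∷ sy ∷ []))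

  corner-D : ∀ sx sy → sx ≤ 0ℤ → D (sx - ((P - + 1) + + 1)) (sy - ((sy - + 1) + 0ℤ))
  corner-D sx sy sx≤0 =
    ≤-by (slack sx≤0) (solve (P ∷ sx ∷ sy ∷ [])) ,
    ≤-by (0≤P³-1 ⊕ 0≤P ⊗ 0≤P ⊗ slack sx≤0) (solve (P ∷ sx ∷ sy ∷ []))

  slant-Δ : ∀ A C sx sy tx ty → tx + + 1 ≤ sx → C ≤ A → Δ (sx - tx) (sy - ty) (- C) →
    Δ ((sx - + 1) - tx) ((sy + P * P - P * A) - ty) (A - C)
  slant-Δ A C sx sy tx ty tx<sx C≤A (_ , g₂ , _) =
    ≤-by (0≤P ⊗ slack g₂ ⊕ 0≤P³-1 ⊗ slack tx<sx) (solve (P ∷ A ∷ C ∷ sx ∷ sy ∷ tx ∷ ty ∷ [])) ,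
    ≤-by (slack g₂) (solve (P ∷ A ∷ C ∷ sx ∷ sy ∷ tx ∷ ty ∷ [])) ,
    ≤-by (0≤P ⊗ (0≤P ⊗ slack g₂ ⊕ 0≤P³-1 ⊗ slack tx<sx) ⊕ 0≤P³-1 ⊗ slack C≤A)
      (solve (P ∷ A ∷ C ∷ sx ∷ sy ∷ tx ∷ ty ∷ []))

  slant-square : ∀ A C N sx sy tx ty → Square N sx sy → Square N tx ty → Δ (sx - tx) (sy - ty) (- C) →
    tx + + 1 ≤ sx → C ≤ A → A ≤ P - + 1 → Square N (sx - + 1) (sy + P * P - P * A)
  slant-square A C N sx sy tx ty (_ , sx≤N , 0≤sy , _) (0≤tx , _ , _ , ty≤N) (_ , g₂ , _) tx<sx C≤A A≤P-1 =
    ≤-by (slack tx<sx ⊕ slack 0≤tx) (solve (sx ∷ tx ∷ [])) ,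
    ≤-by (slack sx≤N ⊕ nonneg 1) (solve (N ∷ sx ∷ [])) ,
    ≤-by (slack 0≤sy ⊕ 0≤P ⊗ (slack A≤P-1 ⊕ nonneg 1)) (solve (P ∷ A ∷ sy ∷ [])) ,
    ≤-by (slack g₂ ⊕ 0≤P ⊗ 0≤P ⊗ slack tx<sx ⊕ 0≤P ⊗ slack C≤A ⊕ slack ty≤N)
      (solve (P ∷ A ∷ C ∷ N ∷ sx ∷ sy ∷ tx ∷ ty ∷ []))

  slant-D : ∀ A sx sy → D (sx - ((sx - + 1) + + 1)) (sy - ((sy + P * P - P * A) + (- (P * P) + P * A)))
  slant-D A sx sy =
    ≤-by (nonneg 0) (solve (P ∷ A ∷ sx ∷ sy ∷ [])) , ≤-by (nonneg 0) (solve (P ∷ A ∷ sx ∷ sy ∷ []))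

module _ {ℓ} {Q : ℕ → Set ℓ} (Q? : U.Decidable Q) where

  greatest-≤ : ∀ k {c} → Q c → c ℕ.≤ k → ∃[ α ] Q α × (∀ {β} → Q β → β ℕ.≤ k → β ℕ.≤ α)
  greatest-≤ zero Qc z≤n = 0 , Qc , λ _ β≤0 → β≤0
  greatest-≤ (suc k) Qc c≤1+k with Q? (suc k)
  ... | yes Q[1+k] = suc k , Q[1+k] , λ _ β≤1+k → β≤1+k
  ... | no ¬Q[1+k] =
    let α , Qα , max = greatest-≤ k Qc (≤k Qc c≤1+k) in α , Qα , λ Qβ β≤1+k → max Qβ (≤k Qβ β≤1+k)
    where
    ≤k : ∀ {β} → Q β → β ℕ.≤ suc k → β ℕ.≤ k
    ≤k Qβ β≤1+k = ℕP.≤-pred (ℕP.≤∧≢⇒< β≤1+k λ { refl → ¬Q[1+k] Qβ })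

module Consistency (p : ℕ) (2≤p : 2 ℕ.≤ p) (n i : ℕ) (i≤n : i ℕ.≤ n) (J : ℕ → Sub2)
  (J-ideal : ∀ j → suc i ℕ.≤ j → j ℕ.≤ n → IsIdeal p n (J j))
  (consistent-above : BackwardConsistent p n J (suc i))
  (Jᵢ-ideal : IsIdeal p n (J i)) where

  open import Data.Integer using (_+_; _-_; _*_; -_; _≤_; _<_; _≤?_; +≤+)
  open import Data.Integer.Properties using (≤-refl; ≤-trans; ≰⇒>; +-inverseʳ; m-n≡m⊖n; ⊖-≥)
  open IntegerArithmetic

  P N : ℤ
  P = + p
  N = + n

  open Cone P (+≤+ 2≤p)

  Cond-i Cond-ii Cond-iii : Set
  Cond-i = ∀ x y → J (suc i) x y ≡ true → J i x y ≡ true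
  Cond-ii = ShiftIncl p n (J i) (J (suc i)) 0ℤ (- P)
  Cond-iii = ShiftIncl p n (J (i ℕ.+ p)) (J i) (+ 1) 0ℤ

  Cond-iv : ℕ → Set
  Cond-iv α = ShiftIncl p n (J (i ℕ.+ α)) (J i) (+ 1) (- (P * P) + P * + α)

  1≤p : 1 ℕ.≤ p
  1≤p = ℕP.<⇒≤ 2≤p

  1+i≤i+c : ∀ {c} → 1 ℕ.≤ c → suc i ℕ.≤ i ℕ.+ c
  1+i≤i+c = ℕP.m<m+n i

  ≤p-1 : ∀ {α} → α ℕ.≤ p ℕ.∸ 1 → + α ≤ P - + 1
  ≤p-1 {α} α≤p-1 = subst (+ α ≤_) (sym (trans (m-n≡m⊖n p 1) (⊖-≥ 1≤p))) (+≤+ α≤p-1)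

  Δ-at : ∀ {a b z z'} → z ≡ z' → Δ a b z' → Δ a b z
  Δ-at z≡z' = subst (Δ _ _) (sym z≡z')

  ∈U-above : ∀ {j x y} → suc i ℕ.≤ j → j ℕ.≤ n → J j x y ≡ true → InU n x y
  ∈U-above i<j j≤n = proj₁ consistent-above _ i<j j≤n _ _

  closed-above : ∀ {j x y j' x' y'} → suc i ℕ.≤ j → j ℕ.≤ n → J j x y ≡ true →
    suc i ℕ.≤ j' → j' ℕ.≤ n → InU n x' y' → Δ (x' - x) (y' - y) (+ j' - + j) → J j' x' y' ≡ true
  closed-above = proj₂ consistent-above _ _ _ _ _ _

  -- A nonempty ideal of U contains the origin; hence admissibility is decidable.
  admissible⇒origin∈J : ∀ {β} → Admissible p n J i β → J (i ℕ.+ β) 0ℤ 0ℤ ≡ true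
  admissible⇒origin∈J {β} (1≤β , _ , i+β≤n , x , y , xy∈J) =
    proj₂ ideal x y 0ℤ 0ℤ xy∈J origin∈U (D∋⟨-x,-y⟩ x y 0≤x 0≤y)
    where
    ideal = J-ideal (i ℕ.+ β) (1+i≤i+c 1≤β) i+β≤n
    origin∈U : InU n 0ℤ 0ℤ
    origin∈U = ≤-refl , nonneg n , ≤-refl , nonneg n
    0≤x = proj₁ (proj₁ ideal x y xy∈J)
    0≤y = proj₁ (proj₂ (proj₂ (proj₁ ideal x y xy∈J)))

  admissible? : U.Decidable (Admissible p n J i)
  admissible? β with 1 ℕ.≤? β | β ℕ.≤? p ℕ.∸ 1 | i ℕ.+ β ℕ.≤? n | J (i ℕ.+ β) 0ℤ 0ℤ in origin
  ... | yes 1≤β | yes β≤p-1 | yes i+β≤n | true = yes (1≤β , β≤p-1 , i+β≤n , 0ℤ , 0ℤ , origin)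
  ... | yes _ | yes _ | yes _ | false =
    no λ adm → contradiction (trans (sym (admissible⇒origin∈J adm)) origin) λ ()
  ... | no 1≰β | _ | _ | _ = no λ adm → 1≰β (proj₁ adm)
  ... | yes _ | no β≰p-1 | _ | _ = no λ adm → β≰p-1 (proj₁ (proj₂ adm))
  ... | yes _ | yes _ | no i+β≰n | _ = no λ adm → i+β≰n (proj₁ (proj₂ (proj₂ adm)))

  largestAdmissible : ∀ {c} → Admissible p n J i c → ∃[ α ] IsLargestAdmissible p n J i α × c ℕ.≤ α
  largestAdmissible adm@(_ , c≤p-1 , _) =
    let α , adm-α , max = greatest-≤ admissible? (p ℕ.∸ 1) adm c≤p-1
    in α , (adm-α , λ β adm-β → max adm-β (proj₁ (proj₂ adm-β))) , max adm c≤p-1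

  upward : ∀ {c sx sy tx ty} → 1 ℕ.≤ c → i ℕ.+ c ℕ.≤ n → Cond-ii →
    J i sx sy ≡ true → InU n tx ty → Δ (tx - sx) (ty - sy) (+ c) → J (i ℕ.+ c) tx ty ≡ true
  upward {c} {sx} {sy} {tx} {ty} 1≤c i+c≤n cond-ii s∈J t∈U t-s∈Δ with ty + P * (+ c - + 1) ≤? N
  ... | yes raised≤N =
    closed-above ℕP.≤-refl 1+i≤n w∈J (1+i≤i+c 1≤c) i+c≤n t∈U
      (Δ-at ([i+c]-[1+i]≡c-1 (+ i) (+ c)) (raise-Δ (+ c) tx ty (+≤+ 1≤c)))
    where
    1+i≤n = ℕP.≤-trans (1+i≤i+c 1≤c) i+c≤n
    w∈J = cond-ii sx sy tx _ s∈J
      (raise-square (+ c) N tx ty (+≤+ 1≤c) t∈U raised≤N) (raise-D (+ c) sx sy tx ty t-s∈Δ)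
  ... | no raised≰N =
    closed-above ℕP.≤-refl 1+i≤n w∈J (1+i≤i+c 1≤c) i+c≤n t∈U
      (Δ-at ([i+c]-[1+i]≡c-1 (+ i) (+ c)) (lower-Δ (+ c) sx sy tx ty (+≤+ 1≤c) t-s∈Δ))
    where
    1+i≤n = ℕP.≤-trans (1+i≤i+c 1≤c) i+c≤n
    s∈U = proj₁ Jᵢ-ideal sx sy s∈J
    P≤sy = lower-P≤sy (+ c) N sx sy tx ty s∈U t∈U t-s∈Δ (≰⇒> raised≰N)
    w∈J = cond-ii sx sy sx (sy - P) s∈J (lower-square N sx sy s∈U P≤sy) (lower-D sx sy)

  module Downward {c : ℕ} {sx sy tx ty : ℤ} (1≤c : 1 ℕ.≤ c) (i+c≤n : i ℕ.+ c ℕ.≤ n)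
    (t∈J : J (i ℕ.+ c) tx ty ≡ true) (s∈U : InU n sx sy) (s-t∈Δ : Δ (sx - tx) (sy - ty) (- + c)) where

    C : ℤ
    C = + c

    i<i+c : suc i ℕ.≤ i ℕ.+ c
    i<i+c = 1+i≤i+c 1≤c

    t∈U : InU n tx ty
    t∈U = ∈U-above i<i+c i+c≤n t∈J

    i+p≤n : p ℕ.≤ c → i ℕ.+ p ℕ.≤ n
    i+p≤n p≤c = ℕP.≤-trans (ℕP.+-monoʳ-≤ i p≤c) i+c≤n

    via-next : Cond-i → sx ≤ tx → P * ((sx - tx) + P * (sy - ty)) ≤ C - + 1 → J i sx sy ≡ true
    via-next cond-i sx≤tx Pu≤C-1 =
      cond-i sx sy (closed-above i<i+c i+c≤n t∈J ℕP.≤-refl (ℕP.≤-trans i<i+c i+c≤n) s∈U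
        (Δ-at ([1+i]-[i+c]≡1-c (+ i) C) (next-Δ C sx sy tx ty (+≤+ 1≤c) sx≤tx Pu≤C-1)))

    via-left : p ℕ.≤ c → Cond-iii → + 1 ≤ sx → J i sx sy ≡ true
    via-left p≤c cond-iii 1≤sx = cond-iii (sx - + 1) sy sx sy w∈J s∈U (left-D sx sy)
      where
      w∈J = closed-above i<i+c i+c≤n t∈J (1+i≤i+c 1≤p) (i+p≤n p≤c) (left-square N sx sy s∈U 1≤sx)
        (Δ-at ([i+b]-[i+c]≡b-c (+ i) P C) (left-Δ C sx sy tx ty (+≤+ p≤c) s-t∈Δ))

    via-corner : p ℕ.≤ c → Cond-iii → sx ≤ 0ℤ → C - + 1 < P * ((sx - tx) + P * (sy - ty)) → J i sx sy ≡ true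
    via-corner p≤c cond-iii sx≤0 C-1<Pu = cond-iii (P - + 1) (sy - + 1) sx sy w∈J s∈U (corner-D sx sy sx≤0)
      where
      ty<sy = corner-ty<sy C sx sy tx ty sx≤0 (proj₁ t∈U) (+≤+ 1≤c) C-1<Pu
      C≤N = +≤+ (ℕP.≤-trans (ℕP.m≤n+m c i) i+c≤n)
      w-square = corner-square C N sx sy tx ty s∈U t∈U (+≤+ p≤c) C≤N ty<sy
      w∈J = closed-above i<i+c i+c≤n t∈J (1+i≤i+c 1≤p) (i+p≤n p≤c) w-square
        (Δ-at ([i+b]-[i+c]≡b-c (+ i) P C) (corner-Δ C sx sy tx ty (proj₁ s∈U) (+≤+ p≤c) ty<sy s-t∈Δ))

    via-slant : c ℕ.< p → (∀ α → IsLargestAdmissible p n J i α → Cond-iv α) → tx + + 1 ≤ sx → J i sx sy ≡ true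
    via-slant c<p cond-iv tx<sx with largestAdmissible (1≤c , ℕP.∸-monoˡ-≤ 1 c<p , i+c≤n , tx , ty , t∈J)
    ... | α , largest@((1≤α , α≤p-1 , i+α≤n , _) , _) , c≤α =
      cond-iv α largest (sx - + 1) (sy + P * P - P * A) sx sy w∈J s∈U (slant-D A sx sy)
      where
      A = + α
      w∈J = closed-above i<i+c i+c≤n t∈J (1+i≤i+c 1≤α) i+α≤n
        (slant-square A C N sx sy tx ty s∈U t∈U s-t∈Δ tx<sx (+≤+ c≤α) (≤p-1 α≤p-1))
        (Δ-at ([i+b]-[i+c]≡b-c (+ i) A C) (slant-Δ A C sx sy tx ty tx<sx (+≤+ c≤α) s-t∈Δ))

    downward-≥p : p ℕ.≤ c → Cond-i → Cond-iii → J i sx sy ≡ true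
    downward-≥p p≤c cond-i cond-iii with sx ≤? 0ℤ | P * ((sx - tx) + P * (sy - ty)) ≤? C - + 1
    ... | no sx≰0 | _ = via-left p≤c cond-iii (<⇒+1≤ (≰⇒> sx≰0))
    ... | yes sx≤0 | yes Pu≤C-1 = via-next cond-i (≤-trans sx≤0 (proj₁ t∈U)) Pu≤C-1
    ... | yes sx≤0 | no Pu≰C-1 = via-corner p≤c cond-iii sx≤0 (≰⇒> Pu≰C-1)

    downward-<p : c ℕ.< p → Cond-i → (∀ α → IsLargestAdmissible p n J i α → Cond-iv α) → J i sx sy ≡ true
    downward-<p c<p cond-i cond-iv with sx ≤? tx
    ... | yes sx≤tx =
      via-next cond-i sx≤tx (next-small C sx sy tx ty (+≤+ 1≤c) (≤p-1 (ℕP.∸-monoˡ-≤ 1 c<p)) s-t∈Δ)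
    ... | no sx≰tx = via-slant c<p cond-iv (<⇒+1≤ (≰⇒> sx≰tx))

    downward : Cond-i → (i ℕ.+ p ℕ.≤ n → Cond-iii) → (∀ α → IsLargestAdmissible p n J i α → Cond-iv α) →
      J i sx sy ≡ true
    downward cond-i cond-iii cond-iv with p ℕ.≤? c
    ... | yes p≤c = downward-≥p p≤c cond-i (cond-iii (i+p≤n p≤c))
    ... | no p≰c = downward-<p (ℕP.≰⇒> p≰c) cond-i cond-iv

  conditions : BackwardConsistent p n J i → Conditions p n J i
  conditions (∈U , closed) = cond-i , cond-ii , cond-iii , cond-iv
    where
    closed-down : ∀ {j x y x' y'} → i ℕ.≤ j → j ℕ.≤ n → J j x y ≡ true → InU n x' y' →
      Δ (x' - x) (y' - y) (+ i - + j) → J i x' y' ≡ true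
    closed-down i≤j j≤n xy∈J = closed _ _ _ _ _ _ i≤j j≤n xy∈J ℕP.≤-refl i≤n

    cond-i : suc i ℕ.≤ n → Cond-i
    cond-i 1+i≤n x y xy∈J = closed-down (ℕP.n≤1+n i) 1+i≤n xy∈J (∈U (suc i) (ℕP.n≤1+n i) 1+i≤n x y xy∈J)
      (Δ-at (i-[1+i]≡-1 (+ i)) (⟨0,0,-1⟩∈Δ x y))

    cond-ii : suc i ℕ.≤ n → Cond-ii
    cond-ii 1+i≤n x y x' y' xy∈J x'y'∈U x'y'∈D =
      closed i x y (suc i) x' y' ℕP.≤-refl i≤n xy∈J (ℕP.n≤1+n i) 1+i≤n x'y'∈U
        (Δ-at ([1+i]-i≡1 (+ i)) (D+⟨0,-P⟩⊆Δ⟨1⟩ x y x' y' x'y'∈D))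

    cond-iii : i ℕ.+ p ℕ.≤ n → Cond-iii
    cond-iii i+p≤n x y x' y' xy∈J x'y'∈U x'y'∈D = closed-down (ℕP.m≤m+n i p) i+p≤n xy∈J x'y'∈U
      (Δ-at (i-[i+c]≡-c (+ i) P) (D+⟨1,0⟩⊆Δ⟨-P⟩ x y x' y' x'y'∈D))

    cond-iv : ∀ α → IsLargestAdmissible p n J i α → Cond-iv α
    cond-iv α ((_ , α≤p-1 , i+α≤n , _) , _) x y x' y' xy∈J x'y'∈U x'y'∈D =
      closed-down (ℕP.m≤m+n i α) i+α≤n xy∈J x'y'∈U
        (Δ-at (i-[i+c]≡-c (+ i) (+ α)) (D+⟨1,PA-P²⟩⊆Δ⟨-A⟩ (+ α) x y x' y' (≤p-1 α≤p-1) x'y'∈D))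

  data Level : ℕ → Set where
    base  : Level i
    above : ∀ c → 1 ℕ.≤ c → Level (i ℕ.+ c)

  level : ∀ {j} → i ℕ.≤ j → Level j
  level {j} i≤j with i ℕ.≟ j
  ... | yes refl = base
  ... | no i≢j = subst Level (ℕP.m+[n∸m]≡n i≤j) (above (j ℕ.∸ i) (ℕP.m<n⇒0<n∸m (ℕP.≤∧≢⇒< i≤j i≢j)))

  consistency : Conditions p n J i → BackwardConsistent p n J i
  consistency (cond-i , cond-ii , cond-iii , cond-iv) = ∈U , closed
    where
    ∈U : ∀ j → i ℕ.≤ j → j ℕ.≤ n → ∀ x y → J j x y ≡ true → InU n x y
    ∈U j i≤j j≤n x y with level i≤j
    ... | base = proj₁ Jᵢ-ideal x y
    ... | above c 1≤c = ∈U-above (1+i≤i+c 1≤c) j≤n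

    closed : ∀ j x y j' x' y' → i ℕ.≤ j → j ℕ.≤ n → J j x y ≡ true → i ℕ.≤ j' → j' ℕ.≤ n →
      InU n x' y' → Δ (x' - x) (y' - y) (+ j' - + j) → J j' x' y' ≡ true
    closed j x y j' x' y' i≤j j≤n xy∈J i≤j' j'≤n x'y'∈U x'y'-xy∈Δ with level i≤j | level i≤j'
    ... | base | base =
      proj₂ Jᵢ-ideal x y x' y' xy∈J x'y'∈U (Δ⟨0⟩⊆D _ _ (Δ-at (sym (+-inverseʳ (+ i))) x'y'-xy∈Δ))
    ... | base | above c 1≤c =
      upward 1≤c j'≤n (cond-ii (ℕP.≤-trans (1+i≤i+c 1≤c) j'≤n)) xy∈J x'y'∈U
        (Δ-at (sym ([i+c]-i≡c (+ i) (+ c))) x'y'-xy∈Δ)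
    ... | above c 1≤c | base =
      Downward.downward 1≤c j≤n xy∈J x'y'∈U (Δ-at (sym (i-[i+c]≡-c (+ i) (+ c))) x'y'-xy∈Δ)
        (cond-i (ℕP.≤-trans (1+i≤i+c 1≤c) j≤n)) cond-iii cond-iv
    ... | above c 1≤c | above c' 1≤c' =
      closed-above (1+i≤i+c 1≤c) j≤n xy∈J (1+i≤i+c 1≤c') j'≤n x'y'∈U x'y'-xy∈Δ

open import Data.Nat using (ℕ; suc; _≤_; _<_; _*_; _∸_)
open import Data.Nat.DivMod using (_/_)
open import Data.Nat.Divisibility using (_∣_)
open import Data.Nat.Primality using (Prime; prime⇒nonTrivial)
open import Function.Bundles using (_⇔_; mk⇔)

theorem4p5 : (p : ℕ) → Prime p → (m : ℕ) → 0 < m → 3 ∣ m →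
    (n : ℕ) → n ≡ (m / 3) * (p ∸ 1) →
    (i : ℕ) → i ≤ n → (J : ℕ → Sub2) →
    (∀ j → suc i ≤ j → j ≤ n → IsIdeal p n (J j)) →
    BackwardConsistent p n J (suc i) →
    IsIdeal p n (J i) →
    (BackwardConsistent p n J i ⇔ Conditions p n J i)
theorem4p5 p p-prime _ _ _ n _ i i≤n J J-ideal consistent-above Jᵢ-ideal = mk⇔ conditions consistency
  where
  2≤p = ℕ.nonTrivial⇒n>1 p {{prime⇒nonTrivial p-prime}}
  open Consistency p 2≤p n i i≤n J J-ideal consistent-above Jᵢ-ideal
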